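{- Let $(S,\to)$ be a transition system, $\phi$ a predicate on $S$, and $f$ a topological numbering of $\to$ with respect to $\phi$. If $s \in S$ lies on a cycle of positive length, i.e. there is a path $s \to s_1 \to \cdots \to s_n = s$ with $n\ge 1$, then $\neg\phi(s)$.
   Context: A topological numbering of a transition system $(S,\to)$ with respect to a predicate $\phi$ (of accepting states) is a function $f : S \to \mathbb{Z}$ such that (1) for all $s,t$, if $s\to t$ then $f(s)\ge f(t)$; and (2) for all $s,t$, if $s\to t$ and $\phi(s)$ then $f(s) > f(t)$. -}

module Defs where

open import Level using (Level)
open import Data.Integer using (ℤ; _≥_; _>_)
open import Data.Product using (_×_)

IsTopologicalNumbering : {a r p : Level} {S : Set a} (_⟶_ : S → S → Set r)
                         (φ : S → Set p) (f : S → ℤ) → Set _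
IsTopologicalNumbering {S = S} _⟶_ φ f =
  (∀ (s t : S) → s ⟶ t → f s ≥ f t) ×
  (∀ (s t : S) → s ⟶ t → φ s → f s > f t)

-- Along a path the numbering never increases, and a step out of an accepting
-- state strictly decreases it; so a cycle through an accepting s gives f s < f s.
module Submission where

open import Defs
open import Level using (Level)
open import Data.Integer using (ℤ; _≥_; _>_)
open import Data.Integer.Properties using (≤-trans; ≤-<-trans; <-irrefl)
open import Data.Product using (_,_)
open import Relation.Nullary using (¬_)
open import Relation.Binary.PropositionalEquality using (refl)
open import Relation.Binary.Construct.Closure.Transitive using (TransClosure; [_]; _∷_)

module _ {a r : Level} {S : Set a} {_⟶_ : S → S → Set r} {f : S → ℤ} where

  antitone⁺ : (∀ s t → s ⟶ t → f s ≥ f t) →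
              ∀ {s t} → TransClosure _⟶_ s t → f s ≥ f t
  antitone⁺ antitone [ s⟶t ]       = antitone _ _ s⟶t
  antitone⁺ antitone (s⟶u ∷ u⟶⁺t) = ≤-trans (antitone⁺ antitone u⟶⁺t) (antitone _ _ s⟶u)

  strictlyDecreasing⁺ : {p : Level} {φ : S → Set p} → IsTopologicalNumbering _⟶_ φ f →
                        ∀ {s t} → φ s → TransClosure _⟶_ s t → f s > f t
  strictlyDecreasing⁺ (_ , strict) φs [ s⟶t ] = strict _ _ s⟶t φs
  strictlyDecreasing⁺ (antitone , strict) φs (s⟶u ∷ u⟶⁺t) =
    ≤-<-trans (antitone⁺ antitone u⟶⁺t) (strict _ _ s⟶u φs)

proposition2 : {a r p : Level} {S : Set a} (_⟶_ : S → S → Set r) (φ : S → Set p)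
               (f : S → ℤ) → IsTopologicalNumbering _⟶_ φ f →
               (s : S) → TransClosure _⟶_ s s → ¬ φ s
proposition2 _⟶_ φ f numbering s cycle φs =
  <-irrefl refl (strictlyDecreasing⁺ numbering φs cycle)
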